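{- Let $c_n$ denote the minimal Colless index over rooted binary trees with $n$ leaves. Then: (1) for every integer $k\ge0$, $c_{2^k+1}=k$; (2) for every integer $k\ge1$, $c_{2^k-1}=k-1$; (3) for every integer $k\ge1$ and every $j\in\{1,\dots,2^{k-1}-1\}$, $c_{2^{k-1}+j}=c_{2^k-j}$.
   Context: A rooted binary tree with $n\ge2$ leaves is a rooted tree in which the root has degree 2 and every other internal vertex has degree 3 (each internal vertex has exactly two children); the single vertex is the rooted binary tree with one leaf. For a vertex $v$, $\kappa_T(v)$ is the number of leaves descending from $v$ ($1$ if $v$ is a leaf). For an internal vertex $v$ with children $v_1,v_2$, $bal_T(v)=|\kappa_T(v_1)-\kappa_T(v_2)|$, and the Colless index is $\mathcal{C}(T)=\sum_{v\text{ internal}} bal_T(v)$. -}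

module Defs where

open import Data.Nat using (ℕ; zero; suc; _+_; _≤_)
open import Data.Nat using (∣_-_∣)
open import Data.Product using (Σ; _×_)
open import Relation.Binary.PropositionalEquality using (_≡_)

data Tree : Set where
  leaf : Tree
  node : Tree → Tree → Tree

leaves : Tree → ℕ
leaves leaf       = 1
leaves (node l r) = leaves l + leaves r

colless : Tree → ℕ
colless leaf       = 0
colless (node l r) = ∣ leaves l - leaves r ∣ + colless l + colless r

-- "c n ≡ m": m is the minimal Colless index over rooted binary trees with n leaves
IsMinColless : ℕ → ℕ → Set
IsMinColless n m =
  Σ Tree (λ T → leaves T ≡ n × colless T ≡ m)
  × ((T : Tree) → leaves T ≡ n → m ≤ colless T)

module Submission where

-- The maximally balanced tree, splitting n leaves into ⌈n/2⌉ and ⌊n/2⌋ at every vertex, has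
-- Colless index cᵇ n with cᵇ (2m) = 2 cᵇ m and cᵇ (2m+1) = 1 + cᵇ (m+1) + cᵇ m. It is minimal
-- because cᵇ (a + b) ≤ ∣ a - b ∣ + cᵇ a + cᵇ b: by strong induction on a + b, after splitting
-- a and b - a by parity the halves of a + b are sums of halves of a and of b, and the
-- inequality for those smaller sums recombines. The three formulas then follow from the
-- recursion alone: cᵇ vanishes at powers of two, and cᵇ (2^K + i) = cᵇ (2^K + (2^K - i)) by
-- induction on K, since the halves 2^K + ⌈i/2⌉, 2^K + ⌊i/2⌋ of 2^(K+1) + i are, after a swap,
-- the level-K reflections of the halves of its reflection.

open import Defs
open import Data.Nat using (ℕ; suc; _+_; _∸_; _^_; _≤_; _<_)
open import Data.Product using (_×_)
open import Function.Bundles using (_⇔_)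
open import Algebra.Properties.CommutativeSemigroup using (xy∙z≈xz∙y)
open import Data.Empty using (⊥-elim)
open import Data.Nat using (zero; z≤n; s≤s; ∣_-_∣; ⌊_/2⌋; ⌈_/2⌉)
open import Data.Nat.Induction using (<-rec)
open import Data.Nat.Properties
open import Data.Nat.Tactic.RingSolver using (solve-∀)
open import Data.Product using (_,_)
open import Data.Sum using (inj₁; inj₂)
open import Function.Bundles using (mk⇔; module Equivalence)
open import Relation.Binary.PropositionalEquality

balancedTreeWithin : ℕ → ℕ → Tree
balancedTreeWithin zero    _                 = leaf
balancedTreeWithin (suc k) zero              = leaf
balancedTreeWithin (suc k) (suc zero)        = leaf
balancedTreeWithin (suc k) n@(suc (suc _)) =
  node (balancedTreeWithin k ⌈ n /2⌉) (balancedTreeWithin k ⌊ n /2⌋)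

balancedTree : ℕ → Tree
balancedTree n = balancedTreeWithin n n

cᵇ : ℕ → ℕ
cᵇ n = colless (balancedTree n)

private
  ⌈n/2⌉≤pred : ∀ n {k} → suc (suc n) ≤ suc k → ⌈ suc (suc n) /2⌉ ≤ k
  ⌈n/2⌉≤pred n n≤k = ≤-pred (<-≤-trans (⌈n/2⌉<n n) n≤k)

  ⌊n/2⌋≤pred : ∀ n {k} → suc (suc n) ≤ suc k → ⌊ suc (suc n) /2⌋ ≤ k
  ⌊n/2⌋≤pred n n≤k = ≤-pred (<-≤-trans (⌊n/2⌋<n (suc n)) n≤k)

balancedTreeWithin-irrelevant : ∀ {k k′ n} → n ≤ k → n ≤ k′ →
  balancedTreeWithin k n ≡ balancedTreeWithin k′ n
balancedTreeWithin-irrelevant {zero}  {zero}   z≤n _   = refl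
balancedTreeWithin-irrelevant {zero}  {suc k′} z≤n _   = refl
balancedTreeWithin-irrelevant {suc k} {zero}   _   z≤n = refl
balancedTreeWithin-irrelevant {suc k} {suc k′} {zero}        _ _ = refl
balancedTreeWithin-irrelevant {suc k} {suc k′} {suc zero}    _ _ = refl
balancedTreeWithin-irrelevant {suc k} {suc k′} {suc (suc n)} n≤k n≤k′ = cong₂ node
  (balancedTreeWithin-irrelevant (⌈n/2⌉≤pred n n≤k) (⌈n/2⌉≤pred n n≤k′))
  (balancedTreeWithin-irrelevant (⌊n/2⌋≤pred n n≤k) (⌊n/2⌋≤pred n n≤k′))

leaves-balancedTreeWithin : ∀ k n → 1 ≤ n → n ≤ k → leaves (balancedTreeWithin k n) ≡ n
leaves-balancedTreeWithin (suc k) (suc zero)    _ _   = refl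
leaves-balancedTreeWithin (suc k) (suc (suc n)) _ n≤k = begin
  leaves (balancedTreeWithin k ⌈ 2+n /2⌉) + leaves (balancedTreeWithin k ⌊ 2+n /2⌋)
    ≡⟨ cong₂ _+_ (leaves-balancedTreeWithin k _ (s≤s z≤n) (⌈n/2⌉≤pred n n≤k))
                 (leaves-balancedTreeWithin k _ (s≤s z≤n) (⌊n/2⌋≤pred n n≤k)) ⟩
  ⌈ 2+n /2⌉ + ⌊ 2+n /2⌋ ≡⟨ +-comm ⌈ 2+n /2⌉ _ ⟩
  ⌊ 2+n /2⌋ + ⌈ 2+n /2⌉ ≡⟨ ⌊n/2⌋+⌈n/2⌉≡n 2+n ⟩
  2+n ∎
  where
  open ≡-Reasoning
  2+n : ℕ
  2+n = suc (suc n)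

leaves-balancedTree : ∀ n → 1 ≤ n → leaves (balancedTree n) ≡ n
leaves-balancedTree n 1≤n = leaves-balancedTreeWithin n n 1≤n ≤-refl

balancedTree-unfold : ∀ n → 2 ≤ n →
  balancedTree n ≡ node (balancedTree ⌈ n /2⌉) (balancedTree ⌊ n /2⌋)
balancedTree-unfold (suc zero)    (s≤s ())
balancedTree-unfold (suc (suc n)) _ = cong₂ node
  (balancedTreeWithin-irrelevant (⌈n/2⌉≤pred n ≤-refl) ≤-refl)
  (balancedTreeWithin-irrelevant (⌊n/2⌋≤pred n ≤-refl) ≤-refl)

balancedTree-double : ∀ m → 1 ≤ m →
  balancedTree (m + m) ≡ node (balancedTree m) (balancedTree m)
balancedTree-double m 1≤m = begin
  balancedTree (m + m)
    ≡⟨ balancedTree-unfold (m + m) (+-mono-≤ 1≤m 1≤m) ⟩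
  node (balancedTree ⌈ m + m /2⌉) (balancedTree ⌊ m + m /2⌋)
    ≡⟨ sym (cong₂ (λ u v → node (balancedTree u) (balancedTree v))
                  (n≡⌈n+n/2⌉ m) (n≡⌊n+n/2⌋ m)) ⟩
  node (balancedTree m) (balancedTree m) ∎
  where open ≡-Reasoning

balancedTree-double+1 : ∀ m → 1 ≤ m →
  balancedTree (suc (m + m)) ≡ node (balancedTree (suc m)) (balancedTree m)
balancedTree-double+1 m 1≤m = begin
  balancedTree (suc (m + m))
    ≡⟨ balancedTree-unfold (suc (m + m)) (s≤s (≤-trans 1≤m (m≤m+n m m))) ⟩
  node (balancedTree (suc ⌊ m + m /2⌋)) (balancedTree ⌈ m + m /2⌉)
    ≡⟨ sym (cong₂ (λ u v → node (balancedTree (suc u)) (balancedTree v))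
                  (n≡⌊n+n/2⌋ m) (n≡⌈n+n/2⌉ m)) ⟩
  node (balancedTree (suc m)) (balancedTree m) ∎
  where open ≡-Reasoning

cᵇ-double : ∀ m → cᵇ (m + m) ≡ cᵇ m + cᵇ m
cᵇ-double zero      = refl
cᵇ-double m@(suc _) = begin
  colless (balancedTree (m + m))
    ≡⟨ cong colless (balancedTree-double m (s≤s z≤n)) ⟩
  ∣ leaves (balancedTree m) - leaves (balancedTree m) ∣ + cᵇ m + cᵇ m
    ≡⟨ cong (λ z → z + cᵇ m + cᵇ m) (∣n-n∣≡0 (leaves (balancedTree m))) ⟩
  cᵇ m + cᵇ m ∎
  where open ≡-Reasoning

cᵇ-double+1 : ∀ m → 1 ≤ m → cᵇ (suc (m + m)) ≡ suc (cᵇ (suc m) + cᵇ m)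
cᵇ-double+1 m 1≤m = begin
  colless (balancedTree (suc (m + m)))
    ≡⟨ cong colless (balancedTree-double+1 m 1≤m) ⟩
  ∣ leaves (balancedTree (suc m)) - leaves (balancedTree m) ∣ + cᵇ (suc m) + cᵇ m
    ≡⟨ cong₂ (λ u v → ∣ u - v ∣ + cᵇ (suc m) + cᵇ m)
             (leaves-balancedTree (suc m) (s≤s z≤n)) (leaves-balancedTree m 1≤m) ⟩
  ∣ suc m - m ∣ + cᵇ (suc m) + cᵇ m
    ≡⟨ cong (λ z → z + cᵇ (suc m) + cᵇ m)
            (trans (m≤n⇒∣n-m∣≡n∸m (n≤1+n m)) (m+n∸n≡m 1 m)) ⟩
  suc (cᵇ (suc m) + cᵇ m) ∎
  where open ≡-Reasoning

cᵇ-double+1-≥ : ∀ m → cᵇ (suc m) + cᵇ m ≤ cᵇ (suc (m + m))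
cᵇ-double+1-≥ zero      = z≤n
cᵇ-double+1-≥ m@(suc _) = ≤-trans (n≤1+n _) (≤-reflexive (sym (cᵇ-double+1 m (s≤s z≤n))))

data Halving : ℕ → Set where
  even : ∀ a → Halving (a + a)
  odd  : ∀ a → Halving (suc (a + a))

halving : ∀ n → Halving n
halving zero = even zero
halving (suc n) with halving n
... | even a = odd a
... | odd a  = subst Halving (cong suc (+-suc a a)) (even (suc a))

-- The key inequality cᵇ (a + b) ≤ ∣ a - b ∣ + cᵇ a + cᵇ b for b = a + d, free of ∣_-_∣.
Subadditive : ℕ → ℕ → Set
Subadditive x d = cᵇ (x + (x + d)) ≤ d + cᵇ x + cᵇ (x + d)

SubadditiveBelow : ℕ → Set
SubadditiveBelow n = ∀ x d → x + (x + d) < n → Subadditive x d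

subadditive-zero : ∀ d → Subadditive 0 d
subadditive-zero d = m≤n+m (cᵇ d) (d + 0)

subadditive-even-even : ∀ p e → 1 ≤ p →
  SubadditiveBelow ((p + p) + ((p + p) + (e + e))) → Subadditive (p + p) (e + e)
subadditive-even-even p e 1≤p ih = begin
  cᵇ ((p + p) + ((p + p) + (e + e)))                  ≡⟨ cong cᵇ (regroup p e) ⟩
  cᵇ (m + m)                                          ≡⟨ cᵇ-double m ⟩
  cᵇ m + cᵇ m                                         ≤⟨ +-mono-≤ ih-m ih-m ⟩
  (e + cᵇ p + cᵇ (p + e)) + (e + cᵇ p + cᵇ (p + e))   ≡⟨ interchange e (cᵇ p) (cᵇ (p + e)) ⟩
  (e + e) + (cᵇ p + cᵇ p) + (cᵇ (p + e) + cᵇ (p + e))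
    ≡⟨ sym (cong₂ (λ u v → (e + e) + u + v) (cᵇ-double p)
                  (trans (cong cᵇ (regroup-right p e)) (cᵇ-double (p + e)))) ⟩
  (e + e) + cᵇ (p + p) + cᵇ ((p + p) + (e + e)) ∎
  where
  open ≤-Reasoning
  m : ℕ
  m = p + (p + e)
  regroup : ∀ p e → (p + p) + ((p + p) + (e + e)) ≡ (p + (p + e)) + (p + (p + e))
  regroup = solve-∀
  regroup-right : ∀ p e → (p + p) + (e + e) ≡ (p + e) + (p + e)
  regroup-right = solve-∀
  interchange : ∀ a b c → (a + b + c) + (a + b + c) ≡ (a + a) + (b + b) + (c + c)
  interchange = solve-∀
  ih-m : Subadditive p e
  ih-m = ih p e (subst (m <_) (sym (regroup p e)) (m<m+n m (≤-trans 1≤p (m≤m+n p _))))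

subadditive-odd-even : ∀ p e →
  SubadditiveBelow (suc (p + p) + (suc (p + p) + (e + e))) → Subadditive (suc (p + p)) (e + e)
subadditive-odd-even p zero _ rewrite +-identityʳ (suc (p + p)) =
  ≤-reflexive (cᵇ-double (suc (p + p)))
subadditive-odd-even p (suc e) ih = begin
  cᵇ (suc (p + p) + (suc (p + p) + (suc e + suc e)))   ≡⟨ cong cᵇ (regroup p e) ⟩
  cᵇ (m + m)                                           ≡⟨ cᵇ-double m ⟩
  cᵇ m + cᵇ m
    ≡⟨ cong (λ z → cᵇ z + cᵇ m) (sym (shift p e)) ⟩
  cᵇ (suc p + (suc p + e)) + cᵇ m                      ≤⟨ +-mono-≤ ih₁ ih₂ ⟩
  (e + cᵇ (suc p) + cᵇ (suc (p + e))) + (suc (suc e) + cᵇ p + cᵇ (p + suc (suc e)))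
    ≡⟨ cong (λ z → (e + cᵇ (suc p) + cᵇ (suc (p + e))) + (suc (suc e) + cᵇ p + cᵇ z))
            (+-suc-suc p e) ⟩
  (e + cᵇ (suc p) + cᵇ (suc (p + e))) + (suc (suc e) + cᵇ p + cᵇ (suc (suc (p + e))))
    ≡⟨ interchange e (cᵇ (suc p)) (cᵇ p) (cᵇ (suc (p + e))) (cᵇ (suc (suc (p + e)))) ⟩
  (suc e + suc e) + (cᵇ (suc p) + cᵇ p) + (cᵇ (suc (suc (p + e))) + cᵇ (suc (p + e)))
    ≤⟨ +-mono-≤ (+-monoʳ-≤ (suc e + suc e) (cᵇ-double+1-≥ p))
                (cᵇ-double+1-≥ (suc (p + e))) ⟩
  (suc e + suc e) + cᵇ (suc (p + p)) + cᵇ (suc (suc (p + e) + suc (p + e)))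
    ≡⟨ cong (λ z → (suc e + suc e) + cᵇ (suc (p + p)) + cᵇ z) (sym (regroup-right p e)) ⟩
  (suc e + suc e) + cᵇ (suc (p + p)) + cᵇ (suc (p + p) + (suc e + suc e)) ∎
  where
  open ≤-Reasoning
  m s : ℕ
  m = p + (p + suc (suc e))
  s = suc (p + p) + (suc (p + p) + (suc e + suc e))
  regroup : ∀ p e →
    suc (p + p) + (suc (p + p) + (suc e + suc e)) ≡ (p + (p + suc (suc e))) + (p + (p + suc (suc e)))
  regroup = solve-∀
  shift : ∀ p e → suc p + (suc p + e) ≡ p + (p + suc (suc e))
  shift = solve-∀
  +-suc-suc : ∀ p e → p + suc (suc e) ≡ suc (suc (p + e))
  +-suc-suc = solve-∀
  regroup-right : ∀ p e → suc (p + p) + (suc e + suc e) ≡ suc (suc (p + e) + suc (p + e))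
  regroup-right = solve-∀
  interchange : ∀ e a b c d →
    (e + a + c) + (suc (suc e) + b + d) ≡ (suc e + suc e) + (a + b) + (d + c)
  interchange = solve-∀
  1≤m : 1 ≤ m
  1≤m = ≤-trans (s≤s z≤n) (≤-trans (m≤n+m (suc (suc e)) p) (m≤n+m _ p))
  m<s : m < s
  m<s = subst (m <_) (sym (regroup p e)) (m<m+n m 1≤m)
  ih₁ : Subadditive (suc p) e
  ih₁ = ih (suc p) e (subst (_< s) (sym (shift p e)) m<s)
  ih₂ : Subadditive p (suc (suc e))
  ih₂ = ih p (suc (suc e)) m<s

subadditive-even-odd : ∀ p e → 1 ≤ p →
  SubadditiveBelow ((p + p) + ((p + p) + suc (e + e))) → Subadditive (p + p) (suc (e + e))
subadditive-even-odd p e 1≤p ih = begin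
  cᵇ ((p + p) + ((p + p) + suc (e + e)))              ≡⟨ cong cᵇ (regroup p e) ⟩
  cᵇ (suc (m + m))                                    ≡⟨ cᵇ-double+1 m 1≤m ⟩
  suc (cᵇ (suc m) + cᵇ m)
    ≡⟨ cong (λ z → suc (cᵇ z + cᵇ m)) (shift p e) ⟩
  suc (cᵇ (p + (p + suc e)) + cᵇ m)                   ≤⟨ s≤s (+-mono-≤ ih₁ ih₂) ⟩
  suc ((suc e + cᵇ p + cᵇ (p + suc e)) + (e + cᵇ p + cᵇ (p + e)))
    ≡⟨ cong (λ z → suc ((suc e + cᵇ p + cᵇ z) + (e + cᵇ p + cᵇ (p + e)))) (+-suc p e) ⟩
  suc ((suc e + cᵇ p + cᵇ (suc (p + e))) + (e + cᵇ p + cᵇ (p + e)))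
    ≡⟨ interchange e (cᵇ p) (cᵇ (suc (p + e))) (cᵇ (p + e)) ⟩
  suc (e + e) + (cᵇ p + cᵇ p) + suc (cᵇ (suc (p + e)) + cᵇ (p + e))
    ≡⟨ sym (cong₂ (λ u v → suc (e + e) + u + v) (cᵇ-double p)
                  (trans (cong cᵇ (regroup-right p e))
                         (cᵇ-double+1 (p + e) (≤-trans 1≤p (m≤m+n p e))))) ⟩
  suc (e + e) + cᵇ (p + p) + cᵇ ((p + p) + suc (e + e)) ∎
  where
  open ≤-Reasoning
  m s : ℕ
  m = p + (p + e)
  s = (p + p) + ((p + p) + suc (e + e))
  regroup : ∀ p e → (p + p) + ((p + p) + suc (e + e)) ≡ suc ((p + (p + e)) + (p + (p + e)))
  regroup = solve-∀
  shift : ∀ p e → suc (p + (p + e)) ≡ p + (p + suc e)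
  shift = solve-∀
  regroup-right : ∀ p e → (p + p) + suc (e + e) ≡ suc ((p + e) + (p + e))
  regroup-right = solve-∀
  interchange : ∀ e b c d →
    suc ((suc e + b + c) + (e + b + d)) ≡ suc (e + e) + (b + b) + suc (c + d)
  interchange = solve-∀
  1≤m : 1 ≤ m
  1≤m = ≤-trans 1≤p (m≤m+n p _)
  ih₁ : Subadditive p (suc e)
  ih₁ = ih p (suc e)
    (subst (_< s) (shift p e) (subst (suc m <_) (sym (regroup p e)) (s≤s (m<m+n m 1≤m))))
  ih₂ : Subadditive p e
  ih₂ = ih p e (subst (m <_) (sym (regroup p e)) (s≤s (m≤m+n m m)))

subadditive-odd-odd : ∀ p e → 1 ≤ p →
  SubadditiveBelow (suc (p + p) + (suc (p + p) + suc (e + e))) →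
  Subadditive (suc (p + p)) (suc (e + e))
subadditive-odd-odd p e 1≤p ih = begin
  cᵇ (suc (p + p) + (suc (p + p) + suc (e + e)))          ≡⟨ cong cᵇ (regroup p e) ⟩
  cᵇ (suc (m + m))                                        ≡⟨ cᵇ-double+1 m (s≤s z≤n) ⟩
  suc (cᵇ (suc m) + cᵇ m)
    ≡⟨ cong₂ (λ u v → suc (cᵇ u + cᵇ v)) (shift₁ p e) (shift₂ p e) ⟩
  suc (cᵇ (suc p + (suc p + e)) + cᵇ (p + (p + suc e)))   ≤⟨ s≤s (+-mono-≤ ih₁ ih₂) ⟩
  suc ((e + cᵇ (suc p) + cᵇ (suc (p + e))) + (suc e + cᵇ p + cᵇ (p + suc e)))
    ≡⟨ cong (λ z → suc ((e + cᵇ (suc p) + cᵇ (suc (p + e))) + (suc e + cᵇ p + cᵇ z)))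
            (+-suc p e) ⟩
  suc ((e + cᵇ (suc p) + cᵇ (suc (p + e))) + (suc e + cᵇ p + cᵇ (suc (p + e))))
    ≡⟨ interchange e (cᵇ (suc p)) (cᵇ p) (cᵇ (suc (p + e))) ⟩
  suc (e + e) + suc (cᵇ (suc p) + cᵇ p) + (cᵇ (suc (p + e)) + cᵇ (suc (p + e)))
    ≡⟨ sym (cong₂ (λ u v → suc (e + e) + u + v) (cᵇ-double+1 p 1≤p)
                  (trans (cong cᵇ (regroup-right p e)) (cᵇ-double (suc (p + e))))) ⟩
  suc (e + e) + cᵇ (suc (p + p)) + cᵇ (suc (p + p) + suc (e + e)) ∎
  where
  open ≤-Reasoning
  m s : ℕ
  m = suc (p + (p + e))
  s = suc (p + p) + (suc (p + p) + suc (e + e))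
  regroup : ∀ p e →
    suc (p + p) + (suc (p + p) + suc (e + e)) ≡ suc (suc (p + (p + e)) + suc (p + (p + e)))
  regroup = solve-∀
  shift₁ : ∀ p e → suc (suc (p + (p + e))) ≡ suc p + (suc p + e)
  shift₁ = solve-∀
  shift₂ : ∀ p e → suc (p + (p + e)) ≡ p + (p + suc e)
  shift₂ = solve-∀
  regroup-right : ∀ p e → suc (p + p) + suc (e + e) ≡ suc (p + e) + suc (p + e)
  regroup-right = solve-∀
  interchange : ∀ e a b c →
    suc ((e + a + c) + (suc e + b + c)) ≡ suc (e + e) + suc (a + b) + (c + c)
  interchange = solve-∀
  1+m<s : suc m < s
  1+m<s = subst (suc m <_) (sym (regroup p e)) (s≤s (m<m+n m (s≤s z≤n)))
  ih₁ : Subadditive (suc p) e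
  ih₁ = ih (suc p) e (subst (_< s) (shift₁ p e) 1+m<s)
  ih₂ : Subadditive p (suc e)
  ih₂ = ih p (suc e) (subst (_< s) (shift₂ p e) (<-trans (n<1+n m) 1+m<s))

subadditive-one-odd : ∀ e → SubadditiveBelow (1 + (1 + suc (e + e))) → Subadditive 1 (suc (e + e))
subadditive-one-odd e ih = begin
  cᵇ (suc (suc (suc (e + e))))                  ≡⟨ cong cᵇ (cong suc (regroup e)) ⟩
  cᵇ (suc (suc e + suc e))                      ≡⟨ cᵇ-double+1 (suc e) (s≤s z≤n) ⟩
  suc (cᵇ (suc (suc e)) + cᵇ (suc e))           ≤⟨ s≤s (+-monoˡ-≤ (cᵇ (suc e)) ih₁) ⟩
  suc ((e + 0 + cᵇ (suc e)) + cᵇ (suc e))       ≤⟨ m≤n+m _ e ⟩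
  e + suc ((e + 0 + cᵇ (suc e)) + cᵇ (suc e))   ≡⟨ rearrange e (cᵇ (suc e)) ⟩
  suc (e + e) + 0 + (cᵇ (suc e) + cᵇ (suc e))
    ≡⟨ cong (suc (e + e) + 0 +_) (sym (trans (cong cᵇ (regroup e)) (cᵇ-double (suc e)))) ⟩
  suc (e + e) + 0 + cᵇ (suc (suc (e + e))) ∎
  where
  open ≤-Reasoning
  regroup : ∀ e → suc (suc (e + e)) ≡ suc e + suc e
  regroup = solve-∀
  rearrange : ∀ e c → e + suc ((e + 0 + c) + c) ≡ suc (e + e) + 0 + (c + c)
  rearrange = solve-∀
  ih₁ : Subadditive 1 e
  ih₁ = ih 1 e (s≤s (s≤s (s≤s (m≤m+n e e))))

subadditive-step : ∀ x d → SubadditiveBelow (x + (x + d)) → Subadditive x d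
subadditive-step x d ih with halving x | halving d
... | even zero      | _      = subadditive-zero d
... | even p@(suc _) | even e = subadditive-even-even p e (s≤s z≤n) ih
... | even p@(suc _) | odd e  = subadditive-even-odd p e (s≤s z≤n) ih
... | odd p          | even e = subadditive-odd-even p e ih
... | odd zero       | odd e  = subadditive-one-odd e ih
... | odd p@(suc _)  | odd e  = subadditive-odd-odd p e (s≤s z≤n) ih

subadditive : ∀ x d → Subadditive x d
subadditive x d = <-rec P step _ x d refl
  where
  P : ℕ → Set
  P n = ∀ x d → x + (x + d) ≡ n → Subadditive x d
  step : ∀ n → (∀ {m} → m < n → P m) → P n
  step _ rec x d refl = subadditive-step x d (λ x′ d′ lt → rec lt x′ d′ refl)

cᵇ-+-ordered : ∀ {a b} → a ≤ b → cᵇ (a + b) ≤ ∣ a - b ∣ + cᵇ a + cᵇ b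
cᵇ-+-ordered {a} a≤b with m≤n⇒∃[o]m+o≡n a≤b
... | d , refl = subst (λ z → cᵇ (a + (a + d)) ≤ z + cᵇ a + cᵇ (a + d))
                       (sym (∣m-m+n∣≡n a d)) (subadditive a d)

cᵇ-+ : ∀ a b → cᵇ (a + b) ≤ ∣ a - b ∣ + cᵇ a + cᵇ b
cᵇ-+ a b with ≤-total a b
... | inj₁ a≤b = cᵇ-+-ordered a≤b
... | inj₂ b≤a = subst₂ _≤_ (cong cᵇ (+-comm b a)) swap (cᵇ-+-ordered b≤a)
  where
  swap : ∣ b - a ∣ + cᵇ b + cᵇ a ≡ ∣ a - b ∣ + cᵇ a + cᵇ b
  swap = trans (xy∙z≈xz∙y +-commutativeSemigroup ∣ b - a ∣ (cᵇ b) (cᵇ a))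
               (cong (λ z → z + cᵇ a + cᵇ b) (∣-∣-comm b a))

cᵇ≤colless : ∀ T → cᵇ (leaves T) ≤ colless T
cᵇ≤colless leaf       = z≤n
cᵇ≤colless (node l r) = ≤-trans (cᵇ-+ (leaves l) (leaves r))
  (+-mono-≤ (+-monoʳ-≤ ∣ leaves l - leaves r ∣ (cᵇ≤colless l)) (cᵇ≤colless r))

isMinColless-cᵇ : ∀ {n} → 1 ≤ n → IsMinColless n (cᵇ n)
isMinColless-cᵇ {n} 1≤n =
  (balancedTree n , leaves-balancedTree n 1≤n , refl) ,
  λ T leaves≡n → subst (λ k → cᵇ k ≤ colless T) leaves≡n (cᵇ≤colless T)

isMinColless-unique : ∀ {n m m′} → IsMinColless n m → IsMinColless n m′ → m ≡ m′
isMinColless-unique ((T , leaves≡n , refl) , min) ((T′ , leaves′≡n , refl) , min′) =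
  ≤-antisym (min T′ leaves′≡n) (min′ T leaves≡n)

isMinColless⇔≡cᵇ : ∀ {n m} → 1 ≤ n → IsMinColless n m ⇔ m ≡ cᵇ n
isMinColless⇔≡cᵇ 1≤n = mk⇔
  (λ isMin → isMinColless-unique isMin (isMinColless-cᵇ 1≤n))
  (λ { refl → isMinColless-cᵇ 1≤n })

isMinColless-transfer : ∀ {n n′ m} → 1 ≤ n → 1 ≤ n′ → cᵇ n ≡ cᵇ n′ →
  IsMinColless n m ⇔ IsMinColless n′ m
isMinColless-transfer {n} {n′} {m} 1≤n 1≤n′ cᵇ≡ = mk⇔
  (λ isMin → from n′-char (trans (to n-char isMin) cᵇ≡))
  (λ isMin → from n-char (trans (to n′-char isMin) (sym cᵇ≡)))
  where
  open Equivalence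
  n-char : IsMinColless n m ⇔ m ≡ cᵇ n
  n-char = isMinColless⇔≡cᵇ 1≤n
  n′-char : IsMinColless n′ m ⇔ m ≡ cᵇ n′
  n′-char = isMinColless⇔≡cᵇ 1≤n′

2^suc : ∀ k → 2 ^ suc k ≡ 2 ^ k + 2 ^ k
2^suc k = cong (2 ^ k +_) (+-identityʳ (2 ^ k))

1≤2^k : ∀ k → 1 ≤ 2 ^ k
1≤2^k = m^n>0 2

cᵇ-2^k : ∀ k → cᵇ (2 ^ k) ≡ 0
cᵇ-2^k zero    = refl
cᵇ-2^k (suc k) = begin
  cᵇ (2 ^ suc k)            ≡⟨ cong cᵇ (2^suc k) ⟩
  cᵇ (2 ^ k + 2 ^ k)        ≡⟨ cᵇ-double (2 ^ k) ⟩
  cᵇ (2 ^ k) + cᵇ (2 ^ k)   ≡⟨ cong₂ _+_ (cᵇ-2^k k) (cᵇ-2^k k) ⟩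
  0 ∎
  where open ≡-Reasoning

cᵇ-2^k+1 : ∀ k → cᵇ (2 ^ k + 1) ≡ k
cᵇ-2^k+1 zero    = refl
cᵇ-2^k+1 (suc k) = begin
  cᵇ (2 ^ suc k + 1)                     ≡⟨ cong (λ z → cᵇ (z + 1)) (2^suc k) ⟩
  cᵇ (2 ^ k + 2 ^ k + 1)                 ≡⟨ cong cᵇ (+-comm (2 ^ k + 2 ^ k) 1) ⟩
  cᵇ (suc (2 ^ k + 2 ^ k))               ≡⟨ cᵇ-double+1 (2 ^ k) (1≤2^k k) ⟩
  suc (cᵇ (suc (2 ^ k)) + cᵇ (2 ^ k))
    ≡⟨ cong₂ (λ u v → suc (cᵇ u + v)) (+-comm 1 (2 ^ k)) (cᵇ-2^k k) ⟩
  suc (cᵇ (2 ^ k + 1) + 0)               ≡⟨ cong suc (trans (+-identityʳ _) (cᵇ-2^k+1 k)) ⟩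
  suc k ∎
  where open ≡-Reasoning

2^suc∸1 : ∀ k → 2 ^ suc k ∸ 1 ≡ suc ((2 ^ k ∸ 1) + (2 ^ k ∸ 1))
2^suc∸1 k = trans (cong (_∸ 1) (2^suc k)) (double∸1 (2 ^ k) (1≤2^k k))
  where
  double∸1 : ∀ n → 1 ≤ n → n + n ∸ 1 ≡ suc ((n ∸ 1) + (n ∸ 1))
  double∸1 (suc n) _ = +-suc n n

cᵇ-2^k∸1 : ∀ k → cᵇ (2 ^ suc k ∸ 1) ≡ k
cᵇ-2^k∸1 zero    = refl
cᵇ-2^k∸1 (suc k) = begin
  cᵇ (2 ^ suc (suc k) ∸ 1)          ≡⟨ cong cᵇ (2^suc∸1 (suc k)) ⟩
  cᵇ (suc (n + n))
    ≡⟨ cᵇ-double+1 n (subst (1 ≤_) (sym (2^suc∸1 k)) (s≤s z≤n)) ⟩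
  suc (cᵇ (suc n) + cᵇ n)
    ≡⟨ cong₂ (λ u v → suc (cᵇ u + v)) (m+[n∸m]≡n (1≤2^k (suc k))) (cᵇ-2^k∸1 k) ⟩
  suc (cᵇ (2 ^ suc k) + k)          ≡⟨ cong (λ z → suc (z + k)) (cᵇ-2^k (suc k)) ⟩
  suc k ∎
  where
  open ≡-Reasoning
  n : ℕ
  n = 2 ^ suc k ∸ 1

+-double-injective : ∀ {m n} → m + m ≡ n + n → m ≡ n
+-double-injective {m} {n} eq =
  trans (n≡⌊n+n/2⌋ m) (trans (cong ⌊_/2⌋ eq) (sym (n≡⌊n+n/2⌋ n)))

double≢double+1 : ∀ m n → m + m ≢ suc (n + n)
double≢double+1 m n eq = 1+n≢n (trans (sym m≡1+n) m≡n)
  where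
  m≡n : m ≡ n
  m≡n = trans (n≡⌊n+n/2⌋ m) (trans (cong ⌊_/2⌋ eq) (sym (n≡⌈n+n/2⌉ n)))
  m≡1+n : m ≡ suc n
  m≡1+n = trans (n≡⌈n+n/2⌉ m) (trans (cong ⌈_/2⌉ eq) (cong suc (sym (n≡⌊n+n/2⌋ n))))

cᵇ-2^suc+double : ∀ K a → cᵇ (2 ^ suc K + (a + a)) ≡ cᵇ (2 ^ K + a) + cᵇ (2 ^ K + a)
cᵇ-2^suc+double K a = trans (cong cᵇ (regroup (2 ^ K) a)) (cᵇ-double (2 ^ K + a))
  where
  regroup : ∀ y a → y + (y + 0) + (a + a) ≡ (y + a) + (y + a)
  regroup = solve-∀

cᵇ-2^suc+double+1 : ∀ K a →
  cᵇ (2 ^ suc K + suc (a + a)) ≡ suc (cᵇ (2 ^ K + suc a) + cᵇ (2 ^ K + a))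
cᵇ-2^suc+double+1 K a = begin
  cᵇ (2 ^ suc K + suc (a + a))                ≡⟨ cong cᵇ (regroup (2 ^ K) a) ⟩
  cᵇ (suc ((2 ^ K + a) + (2 ^ K + a)))
    ≡⟨ cᵇ-double+1 (2 ^ K + a) (≤-trans (1≤2^k K) (m≤m+n _ a)) ⟩
  suc (cᵇ (suc (2 ^ K + a)) + cᵇ (2 ^ K + a))
    ≡⟨ cong (λ z → suc (cᵇ z + cᵇ (2 ^ K + a))) (sym (+-suc (2 ^ K) a)) ⟩
  suc (cᵇ (2 ^ K + suc a) + cᵇ (2 ^ K + a)) ∎
  where
  open ≡-Reasoning
  regroup : ∀ y a → y + (y + 0) + suc (a + a) ≡ suc ((y + a) + (y + a))
  regroup = solve-∀

cᵇ-reflect : ∀ K {i j} → i + j ≡ 2 ^ K → cᵇ (2 ^ K + i) ≡ cᵇ (2 ^ K + j)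
cᵇ-reflect zero {zero}        refl = refl
cᵇ-reflect zero {suc zero}    refl = refl
cᵇ-reflect zero {suc (suc i)} ()
cᵇ-reflect (suc K) {i} {j} i+j≡2^suc with halving i | halving j
... | even a | even b = begin
  cᵇ (2 ^ suc K + (a + a))                    ≡⟨ cᵇ-2^suc+double K a ⟩
  cᵇ (2 ^ K + a) + cᵇ (2 ^ K + a)             ≡⟨ cong₂ _+_ ih ih ⟩
  cᵇ (2 ^ K + b) + cᵇ (2 ^ K + b)             ≡⟨ sym (cᵇ-2^suc+double K b) ⟩
  cᵇ (2 ^ suc K + (b + b)) ∎
  where
  open ≡-Reasoning
  regroup : ∀ a b → (a + b) + (a + b) ≡ (a + a) + (b + b)
  regroup = solve-∀
  ih : cᵇ (2 ^ K + a) ≡ cᵇ (2 ^ K + b)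
  ih = cᵇ-reflect K (+-double-injective (trans (regroup a b) (trans i+j≡2^suc (2^suc K))))
... | odd a | odd b = begin
  cᵇ (2 ^ suc K + suc (a + a))                        ≡⟨ cᵇ-2^suc+double+1 K a ⟩
  suc (cᵇ (2 ^ K + suc a) + cᵇ (2 ^ K + a))           ≡⟨ cong suc (cong₂ _+_ ih₁ ih₂) ⟩
  suc (cᵇ (2 ^ K + b) + cᵇ (2 ^ K + suc b))           ≡⟨ cong suc (+-comm (cᵇ (2 ^ K + b)) _) ⟩
  suc (cᵇ (2 ^ K + suc b) + cᵇ (2 ^ K + b))           ≡⟨ sym (cᵇ-2^suc+double+1 K b) ⟩
  cᵇ (2 ^ suc K + suc (b + b)) ∎
  where
  open ≡-Reasoning
  regroup : ∀ a b → suc (a + b) + suc (a + b) ≡ suc (a + a) + suc (b + b)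
  regroup = solve-∀
  1+a+b≡2^K : suc (a + b) ≡ 2 ^ K
  1+a+b≡2^K = +-double-injective (trans (regroup a b) (trans i+j≡2^suc (2^suc K)))
  ih₁ : cᵇ (2 ^ K + suc a) ≡ cᵇ (2 ^ K + b)
  ih₁ = cᵇ-reflect K 1+a+b≡2^K
  ih₂ : cᵇ (2 ^ K + a) ≡ cᵇ (2 ^ K + suc b)
  ih₂ = cᵇ-reflect K (trans (+-suc a b) 1+a+b≡2^K)
... | even a | odd b = ⊥-elim (double≢double+1 (2 ^ K) (a + b)
  (sym (trans (regroup a b) (trans i+j≡2^suc (2^suc K)))))
  where
  regroup : ∀ a b → suc ((a + b) + (a + b)) ≡ (a + a) + suc (b + b)
  regroup = solve-∀
... | odd a | even b = ⊥-elim (double≢double+1 (2 ^ K) (a + b)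
  (sym (trans (regroup a b) (trans i+j≡2^suc (2^suc K)))))
  where
  regroup : ∀ a b → suc ((a + b) + (a + b)) ≡ suc (a + a) + (b + b)
  regroup = solve-∀

proposition1 :
    ((k : ℕ) → IsMinColless (2 ^ k + 1) k)
    × ((k : ℕ) → 1 ≤ k → IsMinColless (2 ^ k ∸ 1) (k ∸ 1))
    × ((k j m : ℕ) → 1 ≤ k → 1 ≤ j → j < 2 ^ (k ∸ 1) →
         IsMinColless (2 ^ (k ∸ 1) + j) m ⇔ IsMinColless (2 ^ k ∸ j) m)
proposition1 = powerOfTwoPlusOne , powerOfTwoMinusOne , reflection
  where
  open Equivalence
  powerOfTwoPlusOne : (k : ℕ) → IsMinColless (2 ^ k + 1) k
  powerOfTwoPlusOne k =
    from (isMinColless⇔≡cᵇ (m≤n+m 1 (2 ^ k))) (sym (cᵇ-2^k+1 k))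
  powerOfTwoMinusOne : (k : ℕ) → 1 ≤ k → IsMinColless (2 ^ k ∸ 1) (k ∸ 1)
  powerOfTwoMinusOne (suc k) _ =
    from (isMinColless⇔≡cᵇ (subst (1 ≤_) (sym (2^suc∸1 k)) (s≤s z≤n))) (sym (cᵇ-2^k∸1 k))
  reflection : (k j m : ℕ) → 1 ≤ k → 1 ≤ j → j < 2 ^ (k ∸ 1) →
    IsMinColless (2 ^ (k ∸ 1) + j) m ⇔ IsMinColless (2 ^ k ∸ j) m
  reflection (suc K) j m _ 1≤j j<2^K =
    isMinColless-transfer (≤-trans 1≤j (m≤n+m j _)) (m<n⇒0<n∸m j<2^suc)
      (trans (cᵇ-reflect K (m+[n∸m]≡n j≤2^K)) (cong cᵇ (sym 2^suc∸j)))
    where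
    j≤2^K : j ≤ 2 ^ K
    j≤2^K = <⇒≤ j<2^K
    j<2^suc : j < 2 ^ suc K
    j<2^suc = <-≤-trans j<2^K (subst (2 ^ K ≤_) (sym (2^suc K)) (m≤m+n _ _))
    2^suc∸j : 2 ^ suc K ∸ j ≡ 2 ^ K + (2 ^ K ∸ j)
    2^suc∸j = trans (cong (_∸ j) (2^suc K)) (+-∸-assoc (2 ^ K) j≤2^K)
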